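{- Let $S$ be a minimal $(1,\mu)$-saturating set in $PG(2,q)$. Then (i) $\mu\le (q+1)\binom q2$; (ii) $|S|\le q+\mu+1$ if $\mu\le q+2$, and $|S|\le\min\{q+\mu,\,q^2+q\}$ if $\mu\ge q+3$.
   Context: For a set $S$ of points in $PG(2,q)$ and a line $\ell$, the multiplicity of $\ell$ is $\binom{|\ell\cap S|}{2}$; a secant is a line with $|\ell\cap S|\ge2$. A set $S$ of $n$ points is $(1,\mu)$-saturating if it spans $PG(2,q)$, $S\ne PG(2,q)$, and every point $Q\notin S$ lies on secants of $S$ whose multiplicities sum to at least $\mu$. A $(1,\mu)$-saturating $n$-set is minimal if it does not contain a $(1,\mu)$-saturating set of size $n-1$. -}

module Defs where

open import Level using (0ℓ)
open import Data.Nat using (ℕ; _≤_; _≤ᵇ_; _+_)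
open import Data.Nat.Combinatorics using (_C_)
open import Data.Bool using (Bool; true; false; _∧_)
open import Data.List using (List; []; _∷_; map; _++_; concatMap; length; filterᵇ)
open import Data.Nat.ListAction using (sum)
open import Data.List.Membership.Propositional using (_∈_)
open import Data.List.Relation.Unary.Unique.Propositional using (Unique)
open import Data.Product using (∃; _×_)
open import Relation.Nullary using (¬_; Dec; yes; no)
open import Relation.Nullary.Decidable using (isYes)
open import Relation.Binary.PropositionalEquality using (_≡_)
open import Relation.Binary.Definitions using (DecidableEquality)
open import Algebra.Structures using (IsCommutativeRing)

record FiniteField (q : ℕ) : Set₁ where
  field
    Carrier : Set
    _+F_ : Carrier → Carrier → Carrier
    _*F_ : Carrier → Carrier → Carrier
    -F_  : Carrier → Carrier
    0F   : Carrier
    1F   : Carrier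
    isCommutativeRing : IsCommutativeRing _≡_ _+F_ _*F_ -F_ 0F 1F
    0≢1 : ¬ (0F ≡ 1F)
    inverse : ∀ x → ¬ (x ≡ 0F) → ∃ λ y → x *F y ≡ 1F
    _≟F_ : DecidableEquality Carrier
    elements : List Carrier
    complete : ∀ x → x ∈ elements
    unique : Unique elements
    size : length elements ≡ q

-- Points of PG(2,F) as canonical representatives of nonzero vectors
-- up to scalars: (1,y,z), (0,1,z), (0,0,1).  Lines use the same
-- representation (duality): line [a] contains point P iff a·P = 0.
data Pt (A : Set) : Set where
  p1 : A → A → Pt A
  p2 : A → Pt A
  p3 : Pt A

module PG {q : ℕ} (F : FiniteField q) where
  open FiniteField F

  Point : Set
  Point = Pt Carrier

  Line : Set
  Line = Pt Carrier

  record Vec3 : Set where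
    constructor ⟨_,_,_⟩
    field x y z : Carrier

  coords : Pt Carrier → Vec3
  coords (p1 y z) = ⟨ 1F , y , z ⟩
  coords (p2 z)   = ⟨ 0F , 1F , z ⟩
  coords p3       = ⟨ 0F , 0F , 1F ⟩

  dot : Vec3 → Vec3 → Carrier
  dot ⟨ a , b , c ⟩ ⟨ x , y , z ⟩ = ((a *F x) +F (b *F y)) +F (c *F z)

  inc : Line → Point → Bool
  inc ℓ P = isYes (dot (coords ℓ) (coords P) ≟F 0F)

  allPts : List Point
  allPts = p3 ∷ (map p2 elements ++ concatMap (λ y → map (p1 y) elements) elements)

  PointSet : Set
  PointSet = Point → Bool

  card : PointSet → ℕ
  card S = length (filterᵇ S allPts)

  meet : PointSet → Line → ℕ
  meet S ℓ = length (filterᵇ (λ P → S P ∧ inc ℓ P) allPts)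

  mult : PointSet → Line → ℕ
  mult S ℓ = meet S ℓ C 2

  secantDegree : PointSet → Point → ℕ
  secantDegree S Q =
    sum (map (mult S) (filterᵇ (λ ℓ → inc ℓ Q ∧ (2 ≤ᵇ meet S ℓ)) allPts))

  Spans : PointSet → Set
  Spans S = ∀ ℓ → ¬ (∀ P → S P ≡ true → inc ℓ P ≡ true)

  Saturating : PointSet → ℕ → Set
  Saturating S μ =
    Spans S
    × (∃ λ Q → S Q ≡ false)
    × (∀ Q → S Q ≡ false → μ ≤ secantDegree S Q)

  Minimal : PointSet → ℕ → Set
  Minimal S μ =
    Saturating S μ
    × (∀ T → (∀ P → T P ≡ true → S P ≡ true) → card T + 1 ≡ card S
         → ¬ Saturating T μ)

module Submission where

-- Fix a point Q outside a set T. Every point of T lies on one of the q + 1 lines through Q, and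
-- a line meeting T in m points contributes m ≤ C(m,2) + 1, so |T| ≤ secdeg(Q) + q + 1, where
-- secdeg(Q) is the sum of the multiplicities of the secants through Q. Hence any T with
-- |T| ≥ q + μ + 1 satisfies the saturation inequality at every point outside it. If moreover
-- |T| > 2(q + 1), then 2m ≤ C(m,2) + 3 summed over the lines through Q sharpens this to
-- |T| < secdeg(Q) + q + 1, and |T| ≥ q + μ already suffices. Removing one point from a minimal
-- set S of size larger than these thresholds would give a smaller (1,μ)-saturating set (it still
-- spans, having more than q + 1 points), which is impossible. Part (i) holds because each of the
-- q + 1 lines through a point Q ∉ S meets S in at most q points.

open import Defs
open import Level using (0ℓ)
open import Function using (_∘_)
open import Data.Nat using (ℕ; zero; suc; _+_; _*_; _^_; _≤_; _<_; z≤n; s≤s; z<s; _≤ᵇ_)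
import Data.Nat as ℕ
open import Data.Nat.Properties
open import Data.Nat.Combinatorics using (_C_; nC1≡n; nCk+nC[k+1]≡[n+1]C[k+1])
open import Data.Nat.ListAction using (sum)
open import Data.Nat.Tactic.RingSolver using (solve-∀)
open import Algebra.Properties.CommutativeSemigroup +-commutativeSemigroup
  using () renaming (interchange to +-interchange)
import Data.Maybe as Maybe
open import Data.Unit using (tt)
open import Data.Empty using (⊥-elim)
open import Data.Bool using (Bool; true; false; _∧_; not; if_then_else_)
import Data.Bool as Bool
open import Data.Bool.Properties using (∧-zeroʳ)
open import Data.Product using (∃; _×_; _,_; proj₁; proj₂)
open import Data.List
  using (List; []; _∷_; [_]; map; _++_; concatMap; length; filterᵇ; cartesianProductWith)
open import Data.List.Properties
  using (length-filter; filter-some; filter-notAll; length-++; length-map)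
open import Data.List.Membership.Propositional using (_∈_; lose)
open import Data.List.Membership.Propositional.Properties
  using (∈-map⁺; ∈-map⁻; ∈-++⁺ˡ; ∈-++⁺ʳ; ∈-cartesianProductWith⁺; ∈-cartesianProductWith⁻)
open import Data.List.Relation.Unary.Any using (here; there)
open import Data.List.Relation.Unary.All using (All; []; _∷_)
open import Data.List.Relation.Unary.AllPairs using (_∷_)
open import Data.List.Relation.Unary.Unique.Propositional using (Unique)
import Data.List.Relation.Unary.All as All
import Data.List.Relation.Unary.All.Properties as All
import Data.List.Relation.Unary.Unique.Propositional.Properties as Unique
open import Relation.Nullary using (¬_; Dec; yes; no; contradiction)
open import Relation.Nullary.Decidable using (T?; isYes; dec⇒maybe)
open import Relation.Binary.PropositionalEquality hiding ([_])
open import Relation.Binary.Definitions using (DecidableEquality)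
open import Algebra.Bundles using (CommutativeRing)

∧≡true⇒ˡ : ∀ {a b} → a ∧ b ≡ true → a ≡ true
∧≡true⇒ˡ {true} _ = refl

∧≡true⇒ʳ : ∀ {a b} → a ∧ b ≡ true → b ≡ true
∧≡true⇒ʳ {true} b≡true = b≡true

∧≡true⇐ : ∀ {a b} → a ≡ true → b ≡ true → a ∧ b ≡ true
∧≡true⇐ refl refl = refl

module _ {A : Set} where

  isYes≡true⇒ : (d : Dec A) → isYes d ≡ true → A
  isYes≡true⇒ (yes a) _ = a

  isYes≡true⇐ : (d : Dec A) → A → isYes d ≡ true
  isYes≡true⇐ (yes _) _ = refl
  isYes≡true⇐ (no ¬a) a = contradiction a ¬a

  isYes≡false⇐ : (d : Dec A) → ¬ A → isYes d ≡ false
  isYes≡false⇐ (yes a) ¬a = contradiction a ¬a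
  isYes≡false⇐ (no _) _ = refl

module _ {A : Set} where

  -- PG.card and PG.meet unfold to countᵇ over allPts, and PG.secantDegree to a sumFilterᵇ.
  countᵇ : (A → Bool) → List A → ℕ
  countᵇ p xs = length (filterᵇ p xs)

  sumFilterᵇ : (A → Bool) → (A → ℕ) → List A → ℕ
  sumFilterᵇ p f xs = sum (map f (filterᵇ p xs))

  countᵇ-≤-length : ∀ p xs → countᵇ p xs ≤ length xs
  countᵇ-≤-length p = length-filter (T? ∘ p)

  countᵇ-<-length : ∀ (p : A → Bool) {a} xs → a ∈ xs → p a ≡ false → countᵇ p xs < length xs
  countᵇ-<-length p xs a∈xs pa = filter-notAll (T? ∘ p) xs (lose a∈xs (subst Bool.T pa))

  countᵇ-mono : ∀ {p r : A → Bool} → (∀ x → p x ≡ true → r x ≡ true) →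
                ∀ xs → countᵇ p xs ≤ countᵇ r xs
  countᵇ-mono h [] = z≤n
  countᵇ-mono {p} {r} h (x ∷ xs) with p x | r x | h x
  ... | true  | true  | _  = s≤s (countᵇ-mono h xs)
  ... | true  | false | hx with () ← hx refl
  ... | false | true  | _  = m≤n⇒m≤1+n (countᵇ-mono h xs)
  ... | false | false | _  = countᵇ-mono h xs

  countᵇ-mono-< : ∀ {p r : A → Bool} → (∀ x → p x ≡ true → r x ≡ true) →
                  ∀ {a} xs → a ∈ xs → r a ≡ true → p a ≡ false → countᵇ p xs < countᵇ r xs
  countᵇ-mono-< h (x ∷ xs) (here refl) ra pa rewrite ra | pa = s≤s (countᵇ-mono h xs)
  countᵇ-mono-< {p} {r} h (x ∷ xs) (there a∈xs) ra pa with p x | r x | h x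
  ... | true  | true  | _  = s≤s (countᵇ-mono-< h xs a∈xs ra pa)
  ... | true  | false | hx with () ← hx refl
  ... | false | true  | _  = m≤n⇒m≤1+n (countᵇ-mono-< h xs a∈xs ra pa)
  ... | false | false | _  = countᵇ-mono-< h xs a∈xs ra pa

  countᵇ-[x]≡0 : ∀ {p : A → Bool} {x} → p x ≡ false → countᵇ p [ x ] ≡ 0
  countᵇ-[x]≡0 px rewrite px = refl

  countᵇ-[x]≡1 : ∀ {p : A → Bool} {x} → p x ≡ true → countᵇ p [ x ] ≡ 1
  countᵇ-[x]≡1 px rewrite px = refl

  countᵇ-none : ∀ {p : A → Bool} → (∀ x → p x ≡ false) → ∀ xs → countᵇ p xs ≡ 0
  countᵇ-none h [] = refl
  countᵇ-none {p} h (x ∷ xs) rewrite h x = countᵇ-none h xs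

  countᵇ-positive : ∀ {p : A → Bool} {a} xs → a ∈ xs → p a ≡ true → 0 < countᵇ p xs
  countᵇ-positive {p} xs a∈xs pa = filter-some (T? ∘ p) (lose a∈xs (subst Bool.T (sym pa) tt))

  countᵇ-witness : ∀ {p : A → Bool} xs → 0 < countᵇ p xs → ∃ λ x → p x ≡ true
  countᵇ-witness {p} (x ∷ xs) pos with p x in px
  ... | true  = x , px
  ... | false = countᵇ-witness xs pos

  countᵇ-≤1 : ∀ {p : A → Bool} xs → Unique xs → (∀ a b → p a ≡ true → p b ≡ true → a ≡ b) →
              countᵇ p xs ≤ 1
  countᵇ-≤1 [] _ _ = z≤n
  countᵇ-≤1 {p} (x ∷ xs) (x∉xs ∷ unique) inj with p x in px
  ... | true  = s≤s (≤-reflexive (countᵇ-absent xs x∉xs))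
    where
    countᵇ-absent : ∀ ys → All (λ y → ¬ x ≡ y) ys → countᵇ p ys ≡ 0
    countᵇ-absent [] [] = refl
    countᵇ-absent (y ∷ ys) (x≢y ∷ x∉ys) with p y in py
    ... | true  = contradiction (inj x y px py) x≢y
    ... | false = countᵇ-absent ys x∉ys
  ... | false = countᵇ-≤1 xs unique inj

  countᵇ-split : ∀ (p r : A → Bool) xs →
                 countᵇ p xs ≡ countᵇ (λ x → p x ∧ not (r x)) xs + countᵇ (λ x → p x ∧ r x) xs
  countᵇ-split p r [] = refl
  countᵇ-split p r (x ∷ xs) with p x | r x
  ... | false | _     = countᵇ-split p r xs
  ... | true  | true  = trans (cong suc (countᵇ-split p r xs)) (sym (+-suc _ _))
  ... | true  | false = cong suc (countᵇ-split p r xs)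

  countᵇ-++ : ∀ (p : A → Bool) xs ys → countᵇ p (xs ++ ys) ≡ countᵇ p xs + countᵇ p ys
  countᵇ-++ p [] ys = refl
  countᵇ-++ p (x ∷ xs) ys with p x
  ... | true  = cong suc (countᵇ-++ p xs ys)
  ... | false = countᵇ-++ p xs ys

  sumFilterᵇ-cong : ∀ {p : A → Bool} {f g : A → ℕ} → (∀ x → p x ≡ true → f x ≡ g x) →
                    ∀ xs → sumFilterᵇ p f xs ≡ sumFilterᵇ p g xs
  sumFilterᵇ-cong e [] = refl
  sumFilterᵇ-cong {p} e (x ∷ xs) with p x in px
  ... | true  = cong₂ _+_ (e x px) (sumFilterᵇ-cong e xs)
  ... | false = sumFilterᵇ-cong e xs

  sumFilterᵇ-∧ : ∀ (p r : A → Bool) (f : A → ℕ) → (∀ x → r x ≡ false → f x ≡ 0) →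
                 ∀ xs → sumFilterᵇ (λ x → p x ∧ r x) f xs ≡ sumFilterᵇ p f xs
  sumFilterᵇ-∧ p r f f≡0 [] = refl
  sumFilterᵇ-∧ p r f f≡0 (x ∷ xs) with p x | r x in rx
  ... | false | _     = sumFilterᵇ-∧ p r f f≡0 xs
  ... | true  | true  = cong (f x +_) (sumFilterᵇ-∧ p r f f≡0 xs)
  ... | true  | false =
    trans (sumFilterᵇ-∧ p r f f≡0 xs) (cong (_+ sumFilterᵇ p f xs) (sym (f≡0 x rx)))

  sumFilterᵇ-+ : ∀ (p : A → Bool) (f g : A → ℕ) xs →
                 sumFilterᵇ p (λ x → f x + g x) xs ≡ sumFilterᵇ p f xs + sumFilterᵇ p g xs
  sumFilterᵇ-+ p f g [] = refl
  sumFilterᵇ-+ p f g (x ∷ xs) with p x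
  ... | true  = trans (cong (f x + g x +_) (sumFilterᵇ-+ p f g xs))
                      (+-interchange (f x) (g x) _ _)
  ... | false = sumFilterᵇ-+ p f g xs

  sumFilterᵇ-≥ : ∀ (p : A → Bool) (f : A → ℕ) {a} xs → a ∈ xs → p a ≡ true → f a ≤ sumFilterᵇ p f xs
  sumFilterᵇ-≥ p f (x ∷ xs) (here refl) pa rewrite pa = m≤m+n (f x) _
  sumFilterᵇ-≥ p f (x ∷ xs) (there a∈xs) pa with p x
  ... | true  = ≤-trans (sumFilterᵇ-≥ p f xs a∈xs pa) (m≤n+m _ (f x))
  ... | false = sumFilterᵇ-≥ p f xs a∈xs pa

  sumFilterᵇ-mono : ∀ (p : A → Bool) {f g : A → ℕ} → (∀ x → p x ≡ true → f x ≤ g x) →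
                    ∀ xs → sumFilterᵇ p f xs ≤ sumFilterᵇ p g xs
  sumFilterᵇ-mono p f≤g [] = z≤n
  sumFilterᵇ-mono p f≤g (x ∷ xs) with p x in px
  ... | true  = +-mono-≤ (f≤g x px) (sumFilterᵇ-mono p f≤g xs)
  ... | false = sumFilterᵇ-mono p f≤g xs

  sumFilterᵇ-const : ∀ (p : A → Bool) k xs → sumFilterᵇ p (λ _ → k) xs ≡ countᵇ p xs * k
  sumFilterᵇ-const p k [] = refl
  sumFilterᵇ-const p k (x ∷ xs) with p x
  ... | true  = cong (k +_) (sumFilterᵇ-const p k xs)
  ... | false = sumFilterᵇ-const p k xs

module _ {A B : Set} where

  countᵇ-map : ∀ (p : B → Bool) (f : A → B) xs → countᵇ p (map f xs) ≡ countᵇ (p ∘ f) xs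
  countᵇ-map p f [] = refl
  countᵇ-map p f (x ∷ xs) with p (f x)
  ... | true  = cong suc (countᵇ-map p f xs)
  ... | false = countᵇ-map p f xs

  countᵇ-≤-sumFilterᵇ : ∀ (p : A → Bool) (r : B → Bool) (I : B → A → Bool) (ℓs : List B) →
    (∀ x → p x ≡ true → ∃ λ ℓ → ℓ ∈ ℓs × r ℓ ≡ true × I ℓ x ≡ true) →
    ∀ xs → countᵇ p xs ≤ sumFilterᵇ r (λ ℓ → countᵇ (I ℓ) xs) ℓs
  countᵇ-≤-sumFilterᵇ p r I ℓs cover [] = z≤n
  countᵇ-≤-sumFilterᵇ p r I ℓs cover (x ∷ xs) = begin
    countᵇ p (x ∷ xs)
      ≡⟨ countᵇ-++ p [ x ] xs ⟩
    countᵇ p [ x ] + countᵇ p xs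
      ≤⟨ +-mono-≤ x-covered (countᵇ-≤-sumFilterᵇ p r I ℓs cover xs) ⟩
    sumFilterᵇ r (λ ℓ → countᵇ (I ℓ) [ x ]) ℓs + sumFilterᵇ r (λ ℓ → countᵇ (I ℓ) xs) ℓs
      ≡⟨ sumFilterᵇ-+ r _ _ ℓs ⟨
    sumFilterᵇ r (λ ℓ → countᵇ (I ℓ) [ x ] + countᵇ (I ℓ) xs) ℓs
      ≡⟨ sumFilterᵇ-cong (λ ℓ _ → countᵇ-++ (I ℓ) [ x ] xs) ℓs ⟨
    sumFilterᵇ r (λ ℓ → countᵇ (I ℓ) (x ∷ xs)) ℓs ∎
    where
    open ≤-Reasoning
    x-covered : countᵇ p [ x ] ≤ sumFilterᵇ r (λ ℓ → countᵇ (I ℓ) [ x ]) ℓs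
    x-covered with p x in px
    ... | false = z≤n
    ... | true with cover x px
    ...   | ℓ , ℓ∈ℓs , rℓ , Iℓx =
      ≤-trans (≤-reflexive (sym (countᵇ-[x]≡1 {p = I ℓ} Iℓx)))
              (sumFilterᵇ-≥ r (λ ℓ → countᵇ (I ℓ) [ x ]) ℓs ℓ∈ℓs rℓ)

module _ {A B C : Set} where

  concatMap-map≡cartesianProductWith : ∀ (f : A → B → C) xs ys →
    concatMap (λ x → map (f x) ys) xs ≡ cartesianProductWith f xs ys
  concatMap-map≡cartesianProductWith f [] ys = refl
  concatMap-map≡cartesianProductWith f (x ∷ xs) ys =
    cong (map (f x) ys ++_) (concatMap-map≡cartesianProductWith f xs ys)

  length-cartesianProductWith : ∀ (f : A → B → C) xs ys →
    length (cartesianProductWith f xs ys) ≡ length xs * length ys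
  length-cartesianProductWith f [] ys = refl
  length-cartesianProductWith f (x ∷ xs) ys = begin
    length (map (f x) ys ++ cartesianProductWith f xs ys)  ≡⟨ length-++ (map (f x) ys) ⟩
    length (map (f x) ys) + length (cartesianProductWith f xs ys)
      ≡⟨ cong₂ _+_ (length-map (f x) ys) (length-cartesianProductWith f xs ys) ⟩
    length ys + length xs * length ys  ∎
    where open ≡-Reasoning

  countᵇ-cartesianProductWith-≤ : ∀ (p : C → Bool) (f : A → B → C) (r : A → Bool) k xs ys →
    (∀ x → countᵇ (p ∘ f x) ys ≤ (if r x then k else 0)) →
    countᵇ p (cartesianProductWith f xs ys) ≤ countᵇ r xs * k
  countᵇ-cartesianProductWith-≤ p f r k [] ys rows = z≤n
  countᵇ-cartesianProductWith-≤ p f r k (x ∷ xs) ys rows = begin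
    countᵇ p (map (f x) ys ++ cartesianProductWith f xs ys)
      ≡⟨ countᵇ-++ p (map (f x) ys) _ ⟩
    countᵇ p (map (f x) ys) + countᵇ p (cartesianProductWith f xs ys)
      ≡⟨ cong (_+ _) (countᵇ-map p (f x) ys) ⟩
    countᵇ (p ∘ f x) ys + countᵇ p (cartesianProductWith f xs ys)
      ≤⟨ +-mono-≤ (rows x) (countᵇ-cartesianProductWith-≤ p f r k xs ys rows) ⟩
    (if r x then k else 0) + countᵇ r xs * k
      ≡⟨ row x ⟩
    countᵇ r (x ∷ xs) * k ∎
    where
    open ≤-Reasoning
    row : ∀ x → (if r x then k else 0) + countᵇ r xs * k ≡ countᵇ r (x ∷ xs) * k
    row x with r x
    ... | true  = refl
    ... | false = refl

-- The binomial coefficient C(n,2)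

[1+n]C2≡n+nC2 : ∀ n → suc n C 2 ≡ n + n C 2
[1+n]C2≡n+nC2 n = trans (sym (nCk+nC[k+1]≡[n+1]C[k+1] n 1)) (cong (_+ n C 2) (nC1≡n n))

nC2≡0 : ∀ n → (2 ≤ᵇ n) ≡ false → n C 2 ≡ 0
nC2≡0 0 _ = refl
nC2≡0 1 _ = refl

C2-mono : ∀ {m n} → m ≤ n → m C 2 ≤ n C 2
C2-mono {zero} _ = z≤n
C2-mono {suc m} {suc n} (s≤s m≤n) rewrite [1+n]C2≡n+nC2 m | [1+n]C2≡n+nC2 n =
  +-mono-≤ m≤n (C2-mono m≤n)

n≤nC2+1 : ∀ n → n ≤ n C 2 + 1
n≤nC2+1 zero = z≤n
n≤nC2+1 (suc n) rewrite [1+n]C2≡n+nC2 n | +-comm (n + n C 2) 1 = s≤s (m≤m+n n (n C 2))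

-- Equivalent to (n - 2)(n - 3) ≥ 0.
2n≤nC2+3 : ∀ n → n + n ≤ n C 2 + 3
2n≤nC2+3 0 = z≤n
2n≤nC2+3 1 = s≤s (s≤s z≤n)
2n≤nC2+3 (suc (suc n)) rewrite [1+n]C2≡n+nC2 (suc n) | [1+n]C2≡n+nC2 n = begin
  suc (suc n) + suc (suc n)        ≡⟨ lhs n ⟩
  (n + n + 4)                      ≤⟨ m≤m+n _ (n C 2) ⟩
  (n + n + 4) + n C 2              ≡⟨ rhs n (n C 2) ⟩
  suc n + (n + n C 2) + 3          ∎
  where
  open ≤-Reasoning
  lhs : ∀ n → suc (suc n) + suc (suc n) ≡ n + n + 4
  lhs = solve-∀
  rhs : ∀ n c → (n + n + 4) + c ≡ suc n + (n + c) + 3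
  rhs = solve-∀

n+n≤b+3k⇒n<b+k : ∀ {n} b k → 2 * k < n → n + n ≤ b + k * 3 → n < b + k
n+n≤b+3k⇒n<b+k {n} b k 2k<n n+n≤b+3k = +-cancelʳ-≤ (2 * k) (suc n) (b + k) (begin
  suc n + 2 * k    ≡⟨ +-suc n (2 * k) ⟨
  n + suc (2 * k)  ≤⟨ +-monoʳ-≤ n 2k<n ⟩
  n + n            ≤⟨ n+n≤b+3k ⟩
  b + k * 3        ≡⟨ rearrange b k ⟩
  b + k + 2 * k    ∎)
  where
  open ≤-Reasoning
  rearrange : ∀ b k → b + k * 3 ≡ b + k + 2 * k
  rearrange = solve-∀

module FieldAlgebra {q : ℕ} (F : FiniteField q) where

  open FiniteField F

  commutativeRing : CommutativeRing 0ℓ 0ℓ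
  commutativeRing = record
    { Carrier = Carrier ; _≈_ = _≡_ ; _+_ = _+F_ ; _*_ = _*F_ ; -_ = -F_
    ; 0# = 0F ; 1# = 1F ; isCommutativeRing = isCommutativeRing }

  module R = CommutativeRing commutativeRing
  open import Algebra.Properties.Ring (CommutativeRing.ring commutativeRing) using (-1*x≈-x)
  open import Algebra.Properties.Group (CommutativeRing.+-group commutativeRing)
    using (x∙y⁻¹≈ε⇒x≈y; ∙-cancelˡ)
  open import Algebra.Properties.Semiring.Mult R.semiring using () renaming (_×_ to _×ℕ_)
  -- Deciding equality of the ℕ-coefficients lets the solver cancel terms such as a *F 0F.
  open import Algebra.Solver.Ring.NaturalCoefficients R.commutativeSemiring
    (λ m n → Maybe.map (cong (_×ℕ 1F)) (dec⇒maybe (m ℕ.≟ n))) public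

  -- Subtraction is written with -1F so that the semiring solver can normalise it.
  -1F : Carrier
  -1F = -F 1F

  _-F_ : Carrier → Carrier → Carrier
  x -F y = x +F (-1F *F y)

  x-Fy≡0⇒x≡y : ∀ x y → x -F y ≡ 0F → x ≡ y
  x-Fy≡0⇒x≡y x y e = x∙y⁻¹≈ε⇒x≈y x y (trans (cong (x +F_) (sym (-1*x≈-x y))) e)

  [1-1]*x≡0 : ∀ x → (1F +F -1F) *F x ≡ 0F
  [1-1]*x≡0 x = begin
    (1F +F -1F) *F x  ≡⟨ cong (_*F x) (R.-‿inverseʳ 1F) ⟩
    0F *F x           ≡⟨ R.zeroˡ x ⟩
    0F                ∎
    where open ≡-Reasoning

  1F≢0F : ¬ 1F ≡ 0F
  1F≢0F e = 0≢1 (sym e)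

  -1F≢0F : ¬ -1F ≡ 0F
  -1F≢0F e = 1F≢0F (begin
    1F           ≡⟨ R.+-identityʳ 1F ⟨
    1F +F 0F     ≡⟨ cong (1F +F_) e ⟨
    1F +F -1F    ≡⟨ R.-‿inverseʳ 1F ⟩
    0F           ∎)
    where open ≡-Reasoning

  linear-root-unique : ∀ A c {z₁ z₂} → ¬ c ≡ 0F →
                       A +F (c *F z₁) ≡ 0F → A +F (c *F z₂) ≡ 0F → z₁ ≡ z₂
  linear-root-unique A c {z₁} {z₂} c≢0 e₁ e₂ = begin
    z₁                 ≡⟨ c⁻¹c z₁ ⟨
    c⁻¹ *F (c *F z₁)   ≡⟨ cong (c⁻¹ *F_) (∙-cancelˡ A _ _ (trans e₁ (sym e₂))) ⟩
    c⁻¹ *F (c *F z₂)   ≡⟨ c⁻¹c z₂ ⟩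
    z₂                 ∎
    where
    open ≡-Reasoning
    c⁻¹ = proj₁ (inverse c c≢0)
    c⁻¹c : ∀ z → c⁻¹ *F (c *F z) ≡ z
    c⁻¹c z = begin
      c⁻¹ *F (c *F z)  ≡⟨ solve 3 (λ c d z → d :* (c :* z) := (c :* d) :* z) refl c c⁻¹ z ⟩
      (c *F c⁻¹) *F z  ≡⟨ cong (_*F z) (proj₂ (inverse c c≢0)) ⟩
      1F *F z          ≡⟨ R.*-identityˡ z ⟩
      z                ∎

module Plane {q : ℕ} (F : FiniteField q) where

  open FiniteField F
  open PG F
  open FieldAlgebra F

  _≟P_ : DecidableEquality Point
  p1 y z ≟P p1 y′ z′ with y ≟F y′ | z ≟F z′
  ... | yes refl | yes refl = yes refl
  ... | no y≢y′  | _        = no λ { refl → y≢y′ refl }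
  ... | yes _    | no z≢z′  = no λ { refl → z≢z′ refl }
  p2 z ≟P p2 z′ with z ≟F z′
  ... | yes refl = yes refl
  ... | no z≢z′  = no λ { refl → z≢z′ refl }
  p3 ≟P p3 = yes refl
  p1 _ _ ≟P p2 _   = no λ ()
  p1 _ _ ≟P p3     = no λ ()
  p2 _   ≟P p1 _ _ = no λ ()
  p2 _   ≟P p3     = no λ ()
  p3     ≟P p1 _ _ = no λ ()
  p3     ≟P p2 _   = no λ ()

  affinePts : List Point
  affinePts = cartesianProductWith p1 elements elements

  allPts≡ : allPts ≡ p3 ∷ (map p2 elements ++ affinePts)
  allPts≡ = cong (λ ps → p3 ∷ (map p2 elements ++ ps))
                 (concatMap-map≡cartesianProductWith p1 elements elements)

  ∈-allPts : ∀ P → P ∈ allPts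
  ∈-allPts P = subst (P ∈_) (sym allPts≡) (∈-pts P)
    where
    ∈-pts : ∀ P → P ∈ p3 ∷ (map p2 elements ++ affinePts)
    ∈-pts (p1 y z) =
      there (∈-++⁺ʳ (map p2 elements) (∈-cartesianProductWith⁺ p1 (complete y) (complete z)))
    ∈-pts (p2 z)   = there (∈-++⁺ˡ (∈-map⁺ p2 (complete z)))
    ∈-pts p3       = here refl

  allPts-unique : Unique allPts
  allPts-unique = subst Unique (sym allPts≡)
    (All.++⁺ (All.map⁺ (All.universal (λ _ ()) elements))
             (All.cartesianProductWith⁺ (setoid _) (setoid _) p1 elements elements (λ _ _ ()))
     ∷ Unique.++⁺ (Unique.map⁺ (λ { refl → refl }) unique)
                  (Unique.cartesianProductWith⁺ p1 (λ { refl → refl , refl }) unique unique)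
                  disjoint)
    where
    disjoint : ∀ {P} → ¬ (P ∈ map p2 elements × P ∈ affinePts)
    disjoint (P∈row , P∈affine)
      with ∈-map⁻ p2 P∈row | ∈-cartesianProductWith⁻ p1 elements elements P∈affine
    ... | _ , _ , refl | _ , _ , _ , _ , ()

  length-allPts : length allPts ≡ suc (q + q * q)
  length-allPts = begin
    length allPts
      ≡⟨ cong length allPts≡ ⟩
    suc (length (map p2 elements ++ affinePts))
      ≡⟨ cong suc (length-++ (map p2 elements)) ⟩
    suc (length (map p2 elements) + length affinePts)
      ≡⟨ cong₂ (λ m n → suc (m + n)) (length-map p2 elements)
                                     (length-cartesianProductWith p1 elements elements) ⟩
    suc (length elements + length elements * length elements)
      ≡⟨ cong (λ n → suc (n + n * n)) size ⟩
    suc (q + q * q)  ∎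
    where open ≡-Reasoning

  countᵇ-allPts : ∀ p →
    countᵇ p allPts ≡ countᵇ p [ p3 ] + (countᵇ (p ∘ p2) elements + countᵇ p affinePts)
  countᵇ-allPts p = begin
    countᵇ p allPts
      ≡⟨ cong (countᵇ p) allPts≡ ⟩
    countᵇ p ([ p3 ] ++ map p2 elements ++ affinePts)
      ≡⟨ countᵇ-++ p [ p3 ] _ ⟩
    countᵇ p [ p3 ] + countᵇ p (map p2 elements ++ affinePts)
      ≡⟨ cong (countᵇ p [ p3 ] +_) (countᵇ-++ p (map p2 elements) _) ⟩
    countᵇ p [ p3 ] + (countᵇ p (map p2 elements) + countᵇ p affinePts)
      ≡⟨ cong (λ n → countᵇ p [ p3 ] + (n + countᵇ p affinePts)) (countᵇ-map p p2 elements) ⟩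
    countᵇ p [ p3 ] + (countᵇ (p ∘ p2) elements + countᵇ p affinePts) ∎
    where open ≡-Reasoning

  NonZero : Vec3 → Set
  NonZero ⟨ a , b , c ⟩ = ¬ (a ≡ 0F × b ≡ 0F × c ≡ 0F)

  orthᵇ : Vec3 → Point → Bool
  orthᵇ v P = isYes (dot v (coords P) ≟F 0F)

  countᵇ-elements-≤ : ∀ p → countᵇ p elements ≤ q
  countᵇ-elements-≤ p = ≤-trans (countᵇ-≤-length p elements) (≤-reflexive size)

  roots-≤1 : ∀ A c → ¬ c ≡ 0F → countᵇ (λ z → isYes ((A +F (c *F z)) ≟F 0F)) elements ≤ 1
  roots-≤1 A c c≢0 = countᵇ-≤1 elements unique λ _ _ e₁ e₂ →
    linear-root-unique A c c≢0 (isYes≡true⇒ _ e₁) (isYes≡true⇒ _ e₂)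

  ¬orthᵇ : ∀ v P {x} → dot v (coords P) ≡ x → ¬ x ≡ 0F → orthᵇ v P ≡ false
  ¬orthᵇ v P v·P≡x x≢0 = isYes≡false⇐ _ λ v·P≡0 → x≢0 (trans (sym v·P≡x) v·P≡0)

  countᵇ-orthᵇ-≤-c≢0 : ∀ a b c → ¬ c ≡ 0F → countᵇ (orthᵇ ⟨ a , b , c ⟩) allPts ≤ suc q
  countᵇ-orthᵇ-≤-c≢0 a b c c≢0 = ≤-trans (≤-reflexive (countᵇ-allPts (orthᵇ ⟨ a , b , c ⟩)))
    (+-mono-≤ (≤-reflexive (countᵇ-[x]≡0 {p = orthᵇ ⟨ a , b , c ⟩} p3∉))
              (+-mono-≤ (roots-≤1 _ c c≢0) affine))
    where
    p3∉ : orthᵇ ⟨ a , b , c ⟩ p3 ≡ false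
    p3∉ = ¬orthᵇ ⟨ a , b , c ⟩ p3
      (solve 3 (λ a b c → ((a :* con 0) :+ (b :* con 0)) :+ (c :* con 1) := c) refl a b c) c≢0
    affine : countᵇ (orthᵇ ⟨ a , b , c ⟩) affinePts ≤ q
    affine = ≤-trans
      (countᵇ-cartesianProductWith-≤ _ p1 (λ _ → true) 1 elements elements λ y → roots-≤1 _ c c≢0)
      (≤-trans (≤-reflexive (*-identityʳ _)) (countᵇ-elements-≤ _))

  countᵇ-orthᵇ-≤-b≢0 : ∀ a b → ¬ b ≡ 0F → countᵇ (orthᵇ ⟨ a , b , 0F ⟩) allPts ≤ suc q
  countᵇ-orthᵇ-≤-b≢0 a b b≢0 = ≤-trans (≤-reflexive (countᵇ-allPts (orthᵇ ⟨ a , b , 0F ⟩)))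
    (+-mono-≤ (countᵇ-≤-length (orthᵇ ⟨ a , b , 0F ⟩) [ p3 ])
              (+-mono-≤ (≤-reflexive p2-row) affine))
    where
    p2-row : countᵇ (orthᵇ ⟨ a , b , 0F ⟩ ∘ p2) elements ≡ 0
    p2-row = countᵇ-none (λ z → ¬orthᵇ ⟨ a , b , 0F ⟩ (p2 z)
      (solve 3 (λ a b z → ((a :* con 0) :+ (b :* con 1)) :+ (con 0 :* z) := b) refl a b z) b≢0)
      elements
    through : Carrier → Bool
    through y = isYes ((a +F (b *F y)) ≟F 0F)
    p1-row : ∀ y → countᵇ (orthᵇ ⟨ a , b , 0F ⟩ ∘ p1 y) elements ≤ (if through y then q else 0)
    p1-row y with (a +F (b *F y)) ≟F 0F
    ... | yes _ = countᵇ-elements-≤ _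
    ... | no ≢0 = ≤-reflexive (countᵇ-none (λ z → ¬orthᵇ ⟨ a , b , 0F ⟩ (p1 y z)
      (solve 4 (λ a b y z → ((a :* con 1) :+ (b :* y)) :+ (con 0 :* z) := a :+ (b :* y))
             refl a b y z) ≢0) elements)
    affine : countᵇ (orthᵇ ⟨ a , b , 0F ⟩) affinePts ≤ q
    affine = ≤-trans (countᵇ-cartesianProductWith-≤ _ p1 through q elements elements p1-row)
      (≤-trans (*-monoˡ-≤ q (roots-≤1 a b b≢0)) (≤-reflexive (+-identityʳ q)))

  countᵇ-orthᵇ-≤-a≢0 : ∀ a → ¬ a ≡ 0F → countᵇ (orthᵇ ⟨ a , 0F , 0F ⟩) allPts ≤ suc q
  countᵇ-orthᵇ-≤-a≢0 a a≢0 = ≤-trans (≤-reflexive (countᵇ-allPts (orthᵇ ⟨ a , 0F , 0F ⟩)))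
    (+-mono-≤ (countᵇ-≤-length (orthᵇ ⟨ a , 0F , 0F ⟩) [ p3 ])
              (≤-trans (+-mono-≤ (countᵇ-elements-≤ _) affine) (≤-reflexive (+-identityʳ q))))
    where
    affine : countᵇ (orthᵇ ⟨ a , 0F , 0F ⟩) affinePts ≤ 0
    affine = ≤-trans
      (countᵇ-cartesianProductWith-≤ _ p1 (λ _ → true) 0 elements elements λ y →
        ≤-reflexive (countᵇ-none (λ z → ¬orthᵇ ⟨ a , 0F , 0F ⟩ (p1 y z)
          (solve 3 (λ a y z → ((a :* con 1) :+ (con 0 :* y)) :+ (con 0 :* z) := a) refl a y z) a≢0)
          elements))
      (≤-reflexive (*-zeroʳ (countᵇ (λ _ → true) elements)))

  -- Writing a point as (x,y,z), the three cases are: the line misses p3 = (0,0,1); it passes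
  -- through p3 but is not x = 0; it is x = 0.
  countᵇ-orthᵇ-≤ : ∀ v → NonZero v → countᵇ (orthᵇ v) allPts ≤ suc q
  countᵇ-orthᵇ-≤ ⟨ a , b , c ⟩ v≢0 with c ≟F 0F
  ... | no c≢0 = countᵇ-orthᵇ-≤-c≢0 a b c c≢0
  ... | yes refl with b ≟F 0F
  ...   | no b≢0 = countᵇ-orthᵇ-≤-b≢0 a b b≢0
  ...   | yes refl = countᵇ-orthᵇ-≤-a≢0 a λ a≡0 → v≢0 (a≡0 , refl , refl)

  coords-nonZero : ∀ P → NonZero (coords P)
  coords-nonZero (p1 _ _) (e , _ , _) = 1F≢0F e
  coords-nonZero (p2 _)   (_ , e , _) = 1F≢0F e
  coords-nonZero p3       (_ , _ , e) = 1F≢0F e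

  pointsOn-≤ : ∀ ℓ → countᵇ (inc ℓ) allPts ≤ suc q
  pointsOn-≤ ℓ = countᵇ-orthᵇ-≤ (coords ℓ) (coords-nonZero ℓ)

  dot-comm : ∀ u w → dot u w ≡ dot w u
  dot-comm ⟨ a , b , c ⟩ ⟨ x , y , z ⟩ =
    solve 6 (λ a b c x y z → ((a :* x) :+ (b :* y)) :+ (c :* z)
                          := ((x :* a) :+ (y :* b)) :+ (z :* c))
          refl a b c x y z

  inc-sym : ∀ ℓ P → inc ℓ P ≡ inc P ℓ
  inc-sym ℓ P = cong (λ x → isYes (x ≟F 0F)) (dot-comm (coords ℓ) (coords P))

  through : Point → Line → Bool
  through P ℓ = inc ℓ P

  linesThrough-≤ : ∀ P → countᵇ (through P) allPts ≤ suc q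
  linesThrough-≤ P = ≤-trans (countᵇ-mono (λ ℓ e → trans (inc-sym P ℓ) e) allPts) (pointsOn-≤ P)

  ⟨⟩-cong : ∀ {a b c a′ b′ c′} → a ≡ a′ → b ≡ b′ → c ≡ c′ → ⟨ a , b , c ⟩ ≡ ⟨ a′ , b′ , c′ ⟩
  ⟨⟩-cong refl refl refl = refl

  scale : Carrier → Vec3 → Vec3
  scale k ⟨ a , b , c ⟩ = ⟨ a *F k , b *F k , c *F k ⟩

  dot-scale : ∀ k v w → dot (scale k v) w ≡ k *F dot v w
  dot-scale k ⟨ a , b , c ⟩ ⟨ x , y , z ⟩ =
    solve 7 (λ k a b c x y z → (((a :* k) :* x) :+ ((b :* k) :* y)) :+ ((c :* k) :* z)
                              := k :* (((a :* x) :+ (b :* y)) :+ (c :* z)))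
          refl k a b c x y z

  coords-proportional : ∀ v → NonZero v → ∃ λ ℓ → ∃ λ k → coords ℓ ≡ scale k v
  coords-proportional ⟨ a , b , c ⟩ v≢0 with a ≟F 0F
  ... | no a≢0 = let (a⁻¹ , aa⁻¹) = inverse a a≢0 in
    p1 (b *F a⁻¹) (c *F a⁻¹) , a⁻¹ , ⟨⟩-cong (sym aa⁻¹) refl refl
  ... | yes refl with b ≟F 0F
  ...   | no b≢0 = let (b⁻¹ , bb⁻¹) = inverse b b≢0 in
    p2 (c *F b⁻¹) , b⁻¹ , ⟨⟩-cong (sym (R.zeroˡ b⁻¹)) (sym bb⁻¹) refl
  ...   | yes refl with c ≟F 0F
  ...     | no c≢0 = let (c⁻¹ , cc⁻¹) = inverse c c≢0 in
    p3 , c⁻¹ , ⟨⟩-cong (sym (R.zeroˡ c⁻¹)) (sym (R.zeroˡ c⁻¹)) (sym cc⁻¹)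
  ...     | yes refl = ⊥-elim (v≢0 (refl , refl , refl))

  lineOrthogonalTo : ∀ v → NonZero v → ∃ λ ℓ → ∀ P → dot v (coords P) ≡ 0F → inc ℓ P ≡ true
  lineOrthogonalTo v v≢0 with coords-proportional v v≢0
  ... | ℓ , k , ℓ≡kv = ℓ , λ P v⊥P → isYes≡true⇐ (dot (coords ℓ) (coords P) ≟F 0F) (begin
    dot (coords ℓ) (coords P)   ≡⟨ cong (λ u → dot u (coords P)) ℓ≡kv ⟩
    dot (scale k v) (coords P)  ≡⟨ dot-scale k v (coords P) ⟩
    k *F dot v (coords P)       ≡⟨ cong (k *F_) v⊥P ⟩
    k *F 0F                     ≡⟨ R.zeroʳ k ⟩
    0F                          ∎)
    where open ≡-Reasoning

  cross : Vec3 → Vec3 → Vec3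
  cross ⟨ u₀ , u₁ , u₂ ⟩ ⟨ w₀ , w₁ , w₂ ⟩ =
    ⟨ (u₁ *F w₂) -F (u₂ *F w₁) , (u₂ *F w₀) -F (u₀ *F w₂) , (u₀ *F w₁) -F (u₁ *F w₀) ⟩

  -- Both identities are (1 - 1)·(a 3×3 determinant with a repeated row).
  dot-cross-left : ∀ u w → dot (cross u w) u ≡ 0F
  dot-cross-left ⟨ u₀ , u₁ , u₂ ⟩ ⟨ w₀ , w₁ , w₂ ⟩ = trans
    (solve 7 (λ u₀ u₁ u₂ w₀ w₁ w₂ m →
       ((((u₁ :* w₂) :+ (m :* (u₂ :* w₁))) :* u₀) :+ (((u₂ :* w₀) :+ (m :* (u₀ :* w₂))) :* u₁))
         :+ (((u₀ :* w₁) :+ (m :* (u₁ :* w₀))) :* u₂)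
       := (con 1 :+ m) :* (((u₀ :* (u₁ :* w₂)) :+ (u₁ :* (u₂ :* w₀))) :+ (u₂ :* (u₀ :* w₁))))
     refl u₀ u₁ u₂ w₀ w₁ w₂ -1F)
    ([1-1]*x≡0 _)

  dot-cross-right : ∀ u w → dot (cross u w) w ≡ 0F
  dot-cross-right ⟨ u₀ , u₁ , u₂ ⟩ ⟨ w₀ , w₁ , w₂ ⟩ = trans
    (solve 7 (λ u₀ u₁ u₂ w₀ w₁ w₂ m →
       ((((u₁ :* w₂) :+ (m :* (u₂ :* w₁))) :* w₀) :+ (((u₂ :* w₀) :+ (m :* (u₀ :* w₂))) :* w₁))
         :+ (((u₀ :* w₁) :+ (m :* (u₁ :* w₀))) :* w₂)
       := (con 1 :+ m) :* (((u₁ :* (w₂ :* w₀)) :+ (u₂ :* (w₀ :* w₁))) :+ (u₀ :* (w₁ :* w₂))))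
     refl u₀ u₁ u₂ w₀ w₁ w₂ -1F)
    ([1-1]*x≡0 _)

  cross-nonZero : ∀ X Y → ¬ X ≡ Y → NonZero (cross (coords X) (coords Y))
  cross-nonZero p3 p3 X≢Y _ = X≢Y refl
  cross-nonZero p3 (p2 z′) _ (e , _ , _) = -1F≢0F (trans
    (solve 2 (λ m z′ → m := (con 0 :* z′) :+ (m :* (con 1 :* con 1))) refl -1F z′) e)
  cross-nonZero p3 (p1 y′ z′) _ (_ , e , _) = 1F≢0F (trans
    (solve 2 (λ m z′ → con 1 := (con 1 :* con 1) :+ (m :* (con 0 :* z′))) refl -1F z′) e)
  cross-nonZero (p2 z) p3 _ (e , _ , _) = 1F≢0F (trans
    (solve 2 (λ m z → con 1 := (con 1 :* con 1) :+ (m :* (z :* con 0))) refl -1F z) e)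
  cross-nonZero (p2 z) (p2 z′) X≢Y (e , _ , _) = X≢Y (cong p2 (sym (x-Fy≡0⇒x≡y z′ z (trans
    (solve 3 (λ m z z′ → z′ :+ (m :* z) := (con 1 :* z′) :+ (m :* (z :* con 1)))
           refl -1F z z′) e))))
  cross-nonZero (p2 z) (p1 y′ z′) _ (_ , _ , e) = -1F≢0F (trans
    (solve 2 (λ m y′ → m := (con 0 :* y′) :+ (m :* (con 1 :* con 1))) refl -1F y′) e)
  cross-nonZero (p1 y z) p3 _ (_ , e , _) = -1F≢0F (trans
    (solve 2 (λ m z → m := (z :* con 0) :+ (m :* (con 1 :* con 1))) refl -1F z) e)
  cross-nonZero (p1 y z) (p2 z′) _ (_ , _ , e) = 1F≢0F (trans
    (solve 2 (λ m y → con 1 := (con 1 :* con 1) :+ (m :* (y :* con 0))) refl -1F y) e)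
  cross-nonZero (p1 y z) (p1 y′ z′) X≢Y (_ , e₁ , e₂) = X≢Y (cong₂ p1
    (sym (x-Fy≡0⇒x≡y y′ y (trans
      (solve 3 (λ m y y′ → y′ :+ (m :* y) := (con 1 :* y′) :+ (m :* (y :* con 1)))
             refl -1F y y′) e₂)))
    (x-Fy≡0⇒x≡y z z′ (trans
      (solve 3 (λ m z z′ → z :+ (m :* z′) := (z :* con 1) :+ (m :* (con 1 :* z′)))
             refl -1F z z′) e₁)))

  lineThrough : ∀ X Y → ¬ X ≡ Y → ∃ λ ℓ → inc ℓ X ≡ true × inc ℓ Y ≡ true
  lineThrough X Y X≢Y with lineOrthogonalTo (cross (coords X) (coords Y)) (cross-nonZero X Y X≢Y)
  ... | ℓ , ⊥⇒inc = ℓ , ⊥⇒inc X (dot-cross-left (coords X) (coords Y))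
                      , ⊥⇒inc Y (dot-cross-right (coords X) (coords Y))

  -- Secant degrees and minimal saturating sets

  secantDegree≡ : ∀ T X → secantDegree T X ≡ sumFilterᵇ (through X) (mult T) allPts
  secantDegree≡ T X =
    sumFilterᵇ-∧ (through X) (λ ℓ → 2 ≤ᵇ meet T ℓ) (mult T) (λ ℓ → nC2≡0 (meet T ℓ)) allPts

  sum[mult+k]≤secantDegree+[1+q]k : ∀ T X k →
    sumFilterᵇ (through X) (λ ℓ → mult T ℓ + k) allPts ≤ secantDegree T X + suc q * k
  sum[mult+k]≤secantDegree+[1+q]k T X k = begin
    sumFilterᵇ (through X) (λ ℓ → mult T ℓ + k) allPts
      ≡⟨ sumFilterᵇ-+ (through X) (mult T) (λ _ → k) allPts ⟩
    sumFilterᵇ (through X) (mult T) allPts + sumFilterᵇ (through X) (λ _ → k) allPts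
      ≡⟨ cong₂ _+_ (secantDegree≡ T X) (sym (sumFilterᵇ-const (through X) k allPts)) ⟨
    secantDegree T X + countᵇ (through X) allPts * k
      ≤⟨ +-monoʳ-≤ (secantDegree T X) (*-monoˡ-≤ k (linesThrough-≤ X)) ⟩
    secantDegree T X + suc q * k  ∎
    where open ≤-Reasoning

  card≤sum-meet : ∀ T X → T X ≡ false → card T ≤ sumFilterᵇ (through X) (meet T) allPts
  card≤sum-meet T X X∉T =
    countᵇ-≤-sumFilterᵇ T (through X) (λ ℓ P → T P ∧ inc ℓ P) allPts cover allPts
    where
    X≢P : ∀ {P} → T P ≡ true → ¬ X ≡ P
    X≢P P∈T refl = contradiction (trans (sym X∉T) P∈T) λ ()
    cover : ∀ P → T P ≡ true → ∃ λ ℓ → ℓ ∈ allPts × inc ℓ X ≡ true × T P ∧ inc ℓ P ≡ true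
    cover P P∈T = let (ℓ , X∈ℓ , P∈ℓ) = lineThrough X P (X≢P P∈T) in
      ℓ , ∈-allPts ℓ , X∈ℓ , ∧≡true⇐ P∈T P∈ℓ

  card≤secantDegree+q+1 : ∀ T X → T X ≡ false → card T ≤ secantDegree T X + suc q
  card≤secantDegree+q+1 T X X∉T = begin
    card T                                              ≤⟨ card≤sum-meet T X X∉T ⟩
    sumFilterᵇ (through X) (meet T) allPts
      ≤⟨ sumFilterᵇ-mono (through X) (λ ℓ _ → n≤nC2+1 (meet T ℓ)) allPts ⟩
    sumFilterᵇ (through X) (λ ℓ → mult T ℓ + 1) allPts  ≤⟨ sum[mult+k]≤secantDegree+[1+q]k T X 1 ⟩
    secantDegree T X + suc q * 1
      ≡⟨ cong (secantDegree T X +_) (*-identityʳ (suc q)) ⟩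
    secantDegree T X + suc q                            ∎
    where open ≤-Reasoning

  card<secantDegree+q+1 : ∀ T X → T X ≡ false → 2 * suc q < card T →
                          card T < secantDegree T X + suc q
  card<secantDegree+q+1 T X X∉T 2[q+1]<T = n+n≤b+3k⇒n<b+k (secantDegree T X) (suc q) 2[q+1]<T (begin
    card T + card T
      ≤⟨ +-mono-≤ (card≤sum-meet T X X∉T) (card≤sum-meet T X X∉T) ⟩
    sumFilterᵇ (through X) (meet T) allPts + sumFilterᵇ (through X) (meet T) allPts
      ≡⟨ sumFilterᵇ-+ (through X) (meet T) (meet T) allPts ⟨
    sumFilterᵇ (through X) (λ ℓ → meet T ℓ + meet T ℓ) allPts
      ≤⟨ sumFilterᵇ-mono (through X) (λ ℓ _ → 2n≤nC2+3 (meet T ℓ)) allPts ⟩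
    sumFilterᵇ (through X) (λ ℓ → mult T ℓ + 3) allPts
      ≤⟨ sum[mult+k]≤secantDegree+[1+q]k T X 3 ⟩
    secantDegree T X + suc q * 3  ∎)
    where open ≤-Reasoning

  meet≤q : ∀ S Q ℓ → S Q ≡ false → inc ℓ Q ≡ true → meet S ℓ ≤ q
  meet≤q S Q ℓ Q∉S Q∈ℓ = ≤-pred (≤-trans
    (countᵇ-mono-< {p = λ P → S P ∧ inc ℓ P} {r = inc ℓ} (λ _ → ∧≡true⇒ʳ)
                   allPts (∈-allPts Q) Q∈ℓ (cong (_∧ inc ℓ Q) Q∉S))
    (pointsOn-≤ ℓ))

  secantDegree≤[q+1]qC2 : ∀ S Q → S Q ≡ false → secantDegree S Q ≤ (q + 1) * (q C 2)
  secantDegree≤[q+1]qC2 S Q Q∉S = begin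
    secantDegree S Q                             ≡⟨ secantDegree≡ S Q ⟩
    sumFilterᵇ (through Q) (mult S) allPts
      ≤⟨ sumFilterᵇ-mono (through Q) (λ ℓ Q∈ℓ → C2-mono (meet≤q S Q ℓ Q∉S Q∈ℓ)) allPts ⟩
    sumFilterᵇ (through Q) (λ _ → q C 2) allPts  ≡⟨ sumFilterᵇ-const (through Q) (q C 2) allPts ⟩
    countᵇ (through Q) allPts * (q C 2)          ≤⟨ *-monoˡ-≤ (q C 2) (linesThrough-≤ Q) ⟩
    suc q * (q C 2)                              ≡⟨ cong (_* (q C 2)) (+-comm 1 q) ⟩
    (q + 1) * (q C 2)                            ∎
    where open ≤-Reasoning

  card≤q²+q : ∀ S Q → S Q ≡ false → card S ≤ q ^ 2 + q
  card≤q²+q S Q Q∉S = ≤-pred (begin-strict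
    card S                   <⟨ countᵇ-<-length S allPts (∈-allPts Q) Q∉S ⟩
    length allPts            ≡⟨ length-allPts ⟩
    suc (q + q * q)          ≡⟨ reorder q ⟩
    suc (q ^ 2 + q)          ∎)
    where
    open ≤-Reasoning
    reorder : ∀ q → suc (q + q * q) ≡ suc (q * (q * 1) + q)
    reorder = solve-∀

  remove : PointSet → Point → PointSet
  remove S P Y = S Y ∧ not (isYes (Y ≟P P))

  card-remove : ∀ S P → S P ≡ true → card (remove S P) + 1 ≡ card S
  card-remove S P P∈S = begin
    card (remove S P) + 1                   ≡⟨ cong (card (remove S P) +_) at-P-once ⟨
    card (remove S P) + countᵇ at-P allPts  ≡⟨ countᵇ-split S (λ Y → isYes (Y ≟P P)) allPts ⟨
    card S                                  ∎
    where
    open ≡-Reasoning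
    at-P : Point → Bool
    at-P Y = S Y ∧ isYes (Y ≟P P)
    at-P-once : countᵇ at-P allPts ≡ 1
    at-P-once = ≤-antisym
      (countᵇ-≤1 {p = at-P} allPts allPts-unique λ Y Y′ Y≡P Y′≡P →
        trans (isYes≡true⇒ (Y ≟P P) (∧≡true⇒ʳ Y≡P)) (sym (isYes≡true⇒ (Y′ ≟P P) (∧≡true⇒ʳ Y′≡P))))
      (countᵇ-positive {p = at-P} allPts (∈-allPts P) (∧≡true⇐ P∈S (isYes≡true⇐ (P ≟P P) refl)))

  P∉remove : ∀ S P → remove S P P ≡ false
  P∉remove S P = trans (cong (λ b → S P ∧ not b) (isYes≡true⇐ (P ≟P P) refl)) (∧-zeroʳ (S P))

  large⇒Spans : ∀ T → suc q < card T → Spans T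
  large⇒Spans T q+1<T ℓ T⊆ℓ = <⇒≱ q+1<T (≤-trans (countᵇ-mono T⊆ℓ allPts) (pointsOn-≤ ℓ))

  large⇒¬Minimal : ∀ S μ k → suc q < k → k < card S →
                   (∀ T → k ≤ card T → ∀ X → T X ≡ false → μ ≤ secantDegree T X) → ¬ Minimal S μ
  large⇒¬Minimal S μ k q+1<k k<S saturates (_ , noSmaller) =
    noSmaller T (λ _ → ∧≡true⇒ˡ) (card-remove S P P∈S)
      (large⇒Spans T (<-≤-trans q+1<k k≤T) , (P , P∉remove S P) , saturates T k≤T)
    where
    P∈S-witness : ∃ λ P → S P ≡ true
    P∈S-witness = countᵇ-witness {p = S} allPts (≤-<-trans z≤n k<S)
    P = proj₁ P∈S-witness
    P∈S = proj₂ P∈S-witness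
    T = remove S P
    k≤T : k ≤ card T
    k≤T = +-cancelʳ-≤ 1 k (card T) (begin
      k + 1               ≡⟨ +-comm k 1 ⟩
      suc k               ≤⟨ k<S ⟩
      card S              ≡⟨ card-remove S P P∈S ⟨
      card T + 1          ∎)
      where open ≤-Reasoning

  q+μ+1≤card⇒μ≤secantDegree : ∀ μ T → q + μ + 1 ≤ card T → ∀ X → T X ≡ false → μ ≤ secantDegree T X
  q+μ+1≤card⇒μ≤secantDegree μ T q+μ+1≤T X X∉T = +-cancelʳ-≤ (suc q) μ (secantDegree T X) (begin
    μ + suc q                 ≡⟨ reorder q μ ⟩
    q + μ + 1                 ≤⟨ q+μ+1≤T ⟩
    card T                    ≤⟨ card≤secantDegree+q+1 T X X∉T ⟩
    secantDegree T X + suc q  ∎)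
    where
    open ≤-Reasoning
    reorder : ∀ q μ → μ + suc q ≡ q + μ + 1
    reorder = solve-∀

  q+μ≤card⇒μ≤secantDegree : ∀ μ → q + 3 ≤ μ →
                            ∀ T → q + μ ≤ card T → ∀ X → T X ≡ false → μ ≤ secantDegree T X
  q+μ≤card⇒μ≤secantDegree μ q+3≤μ T q+μ≤T X X∉T = +-cancelʳ-≤ (suc q) μ (secantDegree T X) (begin
    μ + suc q                 ≡⟨ reorder q μ ⟩
    suc (q + μ)               ≤⟨ s≤s q+μ≤T ⟩
    suc (card T)              ≤⟨ card<secantDegree+q+1 T X X∉T 2[q+1]<T ⟩
    secantDegree T X + suc q  ∎)
    where
    open ≤-Reasoning
    reorder : ∀ q μ → μ + suc q ≡ suc (q + μ)
    reorder = solve-∀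
    expand : ∀ q → suc (2 * suc q) ≡ q + (q + 3)
    expand = solve-∀
    2[q+1]<T : 2 * suc q < card T
    2[q+1]<T = begin
      suc (2 * suc q)  ≡⟨ expand q ⟩
      q + (q + 3)      ≤⟨ +-monoʳ-≤ q q+3≤μ ⟩
      q + μ            ≤⟨ q+μ≤T ⟩
      card T           ∎

  minimal⇒card≤q+μ+1 : ∀ S μ → 1 ≤ μ → Minimal S μ → card S ≤ q + μ + 1
  minimal⇒card≤q+μ+1 S μ 1≤μ minimal = ≮⇒≥ λ q+μ+1<S →
    large⇒¬Minimal S μ (q + μ + 1) q+1<q+μ+1 q+μ+1<S (q+μ+1≤card⇒μ≤secantDegree μ) minimal
    where
    open ≤-Reasoning
    q+1<q+μ+1 : suc q < q + μ + 1
    q+1<q+μ+1 = begin-strict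
      suc q      ≡⟨ +-comm 1 q ⟩
      q + 1      ≤⟨ +-monoʳ-≤ q 1≤μ ⟩
      q + μ      <⟨ m<m+n (q + μ) z<s ⟩
      q + μ + 1  ∎

  minimal⇒card≤q+μ : ∀ S μ → q + 3 ≤ μ → Minimal S μ → card S ≤ q + μ
  minimal⇒card≤q+μ S μ q+3≤μ minimal = ≮⇒≥ λ q+μ<S →
    large⇒¬Minimal S μ (q + μ) q+1<q+μ q+μ<S (q+μ≤card⇒μ≤secantDegree μ q+3≤μ) minimal
    where
    open ≤-Reasoning
    q+1<q+μ : suc q < q + μ
    q+1<q+μ = begin-strict
      suc q      ≡⟨ +-comm 1 q ⟩
      q + 1      <⟨ +-monoʳ-< q (s≤s (s≤s z≤n)) ⟩
      q + 3      ≤⟨ +-monoʳ-≤ q (≤-trans (m≤n+m 3 q) q+3≤μ) ⟩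
      q + μ      ∎

proposition6p1 : ∀ {q : ℕ} (F : FiniteField q) (S : PG.PointSet F) (μ : ℕ)
    → 1 ≤ μ
    → PG.Minimal F S μ
    → (μ ≤ (q + 1) * (q C 2))
      × (μ ≤ q + 2 → PG.card F S ≤ q + μ + 1)
      × (q + 3 ≤ μ → (PG.card F S ≤ q + μ) × (PG.card F S ≤ q ^ 2 + q))
proposition6p1 F S μ 1≤μ minimal@((_ , (Q , Q∉S) , saturated) , _) =
  ≤-trans (saturated Q Q∉S) (secantDegree≤[q+1]qC2 S Q Q∉S) ,
  -- The bound in (ii) does not need μ ≤ q + 2.
  (λ _ → minimal⇒card≤q+μ+1 S μ 1≤μ minimal) ,
  (λ q+3≤μ → minimal⇒card≤q+μ S μ q+3≤μ minimal , card≤q²+q S Q Q∉S)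
  where open Plane F
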